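{- Let $\mathcal T$ be an irreducible planar or toric trinity and $C$ an acyclic component of its state transition graph. Then the image of the map $s\mapsto\varphi_s$, from the set of states in $C$ to the set of integer-valued functions on the black triangles of $\mathcal T$, is closed under pointwise minimum and pointwise maximum: for all $s,t\in C$ there are states $u,w\in C$ with $\varphi_u=\min\{\varphi_s,\varphi_t\}$ and $\varphi_w=\max\{\varphi_s,\varphi_t\}$.
   Context: A trinity is a triangulation $\mathcal T$ of a compact connected oriented closed surface $\Sigma$ whose vertices are colored red, green, blue so that the endpoints of every edge have different colors. A triangle is black if its vertices, read clockwise, appear in the cyclic order blue, green, red; otherwise white. A toric trinity is a trinity on the torus; a planar trinity is a trinity on $S^2$ with a chosen white triangle called outer, whose vertices are called roots. A state of a toric trinity is a bijection between white triangles and vertices matching each white triangle with one of its own vertices; for a planar trinity, between non-outer white triangles and non-root vertices. Clock moves: for a black triangle $\Delta$ with vertices $u_1,u_2,u_3$ in clockwise order and $W_i$ the white triangle sharing the edge $u_iu_{i+1}$ with $\Delta$ (indices mod 3), $\Delta$ is a clockwise empty black triangle of $s$ if $s$ matches $W_i$ with $u_{i+1}$ for all $i$, and counter-clockwise empty if $s$ matches $W_i$ with $u_i$ for all $i$. The clockwise move changing a clockwise empty $\Delta$ replaces the pairs $(W_i,u_{i+1})$ by $(W_i,u_i)$ and leaves all other pairs unchanged; the counter-clockwise move changing $\Delta$ is its inverse. (In an irreducible trinity every clock move is of this form.) The state transition graph has the states as vertices with a directed edge $s\to t$ when $t$ is obtained from $s$ by a clockwise move; components are those of the underlying undirected graph.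 A state is recurrent if it can be returned to by a nonempty sequence of clockwise moves; a component is cyclic if it contains a recurrent state and acyclic otherwise. The functions $\varphi_s$: in an acyclic component $C$ there is a unique state $a$ admitting no counter-clockwise move; every state $s\in C$ can be reached from $a$ by a sequence of clockwise moves; for a black triangle $\Delta$, $\varphi_s(\Delta)$ is the number of times $\Delta$ is changed in such a sequence, which does not depend on the chosen sequence, and distinct states of $C$ have distinct functions $\varphi_s$. Irreducibility: let $\mathcal F$ be the planar trinity with three vertices and two triangles. For a trinity $\mathcal T$, a black triangle $\Delta$ of it and a planar trinity $\mathcal T_0$, the connected sum $\mathcal T\#\mathcal T_0$ is obtained by removing the interior of $\Delta$ and gluing in $\mathcal T_0$ minus the interior of its outer triangle, matching colors on the boundary. It is trivial if $\mathcal T$ or $\mathcal T_0$ is $\mathcal F$. A trinity is irreducible if it is not $\mathcal F$ and is not a nontrivial connected sum. -}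

module Defs where

open import Data.Nat using (ℕ; zero; suc; _+_; _<_; _≤ᵇ_; _⊓_; _⊔_)
open import Data.Bool using (Bool; true; false; if_then_else_)
open import Data.Fin using (Fin; toℕ; punchIn; punchOut; _≟_)
open import Data.Fin.Permutation using (Permutation′; _⟨$⟩ʳ_; _⟨$⟩ˡ_)
open import Data.List using (List; []; _∷_; allFin; upTo; filterᵇ; length)
open import Data.Maybe using (Maybe; just; nothing)
open import Data.Product using (Σ; ∃; ∃₂; _×_; _,_)
open import Data.Sum using (_⊎_; inj₁; inj₂)
open import Data.Unit using (⊤)
open import Data.Empty using (⊥)
open import Function.Bundles using (_↔_; Inverse)
open import Relation.Nullary using (¬_; yes; no)
open import Relation.Binary.PropositionalEquality using (_≡_; _≢_; sym)
open import Relation.Binary.Construct.Closure.ReflexiveTransitive using (Star)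

data Color : Set where
  red green blue : Color

next prev : Color → Color
next red = green
next green = blue
next blue = red
prev red = blue
prev green = red
prev blue = green

-- A properly 3-coloured triangulation of a closed oriented surface has
-- black and white triangles (equally many, n of each: every edge borders
-- exactly one black and one white triangle, and has a well defined colour
-- type).  Black triangles are Fin n, white triangles are Fin n.  The
-- triangulation is completely described by, for each colour c, the
-- bijection  black → white  sending a black triangle Δ to the white
-- triangle glued to Δ along the side of Δ opposite its c-coloured vertex.
-- The orientation is fixed so that black triangles read blue, green, red
-- clockwise.  Vertices of colour c are the cycles of corners of colour c,
-- i.e. the orbits of the rotation `rot c` below on black triangles.

iter : {A : Set} → (A → A) → ℕ → A → A
iter f zero x = x
iter f (suc m) x = f (iter f m x)

allᵇ : {A : Set} → (A → Bool) → List A → Bool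
allᵇ p [] = true
allᵇ p (x ∷ xs) = if p x then allᵇ p xs else false

countᵇ : {A : Set} → (A → Bool) → List A → ℕ
countᵇ p xs = length (filterᵇ p xs)

module Gluing {n : ℕ} (adj : Color → Permutation′ n) where

  toW : Color → Fin n → Fin n
  toW c Δ = adj c ⟨$⟩ʳ Δ

  toB : Color → Fin n → Fin n
  toB c W = adj c ⟨$⟩ˡ W

  Adjacent : Fin n → Fin n → Set
  Adjacent Δ Δ' = ∃₂ λ c d → toB d (toW c Δ) ≡ Δ'

  -- rotation around the vertex of colour k: black → (white across the side
  -- opposite next k, containing the k-corner) → black across the other
  -- side of that white triangle containing the k-corner
  rot : Color → Fin n → Fin n
  rot k Δ = toB (prev k) (toW (next k) Δ)

  SameVertex : Color → Fin n → Fin n → Set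
  SameVertex k Δ Δ' = ∃ λ m → iter (rot k) m Δ ≡ Δ'

  isRep : Color → Fin n → Bool
  isRep k Δ = allᵇ (λ m → toℕ Δ ≤ᵇ toℕ (iter (rot k) m Δ)) (upTo n)

  numVertices : ℕ
  numVertices = countᵇ (isRep red) (allFin n) + countᵇ (isRep green) (allFin n)
                + countᵇ (isRep blue) (allFin n)

  -- the vertex at the k-corner of white triangle W, represented by a black
  -- triangle sharing that vertex (the one glued to W opposite next k)
  cornerRep : Fin n → Color → Fin n
  cornerRep W k = toB (next k) W

record Trinity (n : ℕ) : Set where
  field
    adj       : Color → Permutation′ n
    nonempty  : 0 < n
    connected : ∀ Δ Δ' → Star (Gluing.Adjacent adj) Δ Δ'
  open Gluing adj public

open Trinity public

-- Euler characteristic V - E + F = V - 3n + 2n = V - n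
IsSpherical : ∀ {n} → Trinity n → Set
IsSpherical {n} T = numVertices T ≡ n + 2

IsToroidal : ∀ {n} → Trinity n → Set
IsToroidal {n} T = numVertices T ≡ n

-- The trinity F (three vertices, two triangles): the only trinity with one
-- black triangle.
IsF : ∀ {n} → Trinity n → Set
IsF {n} T = n ≡ 1

-- T' ≅ T # T0 where Δ is a black triangle of T and T0 is a
-- planar trinity with outer (white) triangle O.  Black triangles of T # T0
-- are (black of T minus Δ) ⊎ (black of T0), white triangles are
-- (white of T) ⊎ (white of T0 minus O); "minus one element" is encoded with
-- punchIn / punchOut.

module _ {k j : ℕ} (T : Trinity (suc k)) (Δ : Fin (suc k))
         (T0 : Trinity (suc j)) (O : Fin (suc j)) where

  glue : Color → Fin k ⊎ Fin (suc j) → Fin (suc k) ⊎ Fin j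
  glue c (inj₁ x) = inj₁ (toW T c (punchIn Δ x))
  glue c (inj₂ y) with O ≟ toW T0 c y
  ... | yes _ = inj₁ (toW T c Δ)
  ... | no ne = inj₂ (punchOut ne)

  record IsConnSum {n' : ℕ} (T' : Trinity n') : Set where
    field
      β     : Fin n' ↔ (Fin k ⊎ Fin (suc j))
      ω     : Fin n' ↔ (Fin (suc k) ⊎ Fin j)
      glues : ∀ c b → Inverse.to ω (toW T' c b) ≡ glue c (Inverse.to β b)

NontrivialConnSum : ∀ {n'} → Trinity n' → Set
NontrivialConnSum T' =
  Σ ℕ λ k → Σ ℕ λ j → Σ (Trinity (suc k)) λ T → Σ (Fin (suc k)) λ Δ →
  Σ (Trinity (suc j)) λ T0 → Σ (Fin (suc j)) λ O →
  IsSpherical T0 × ¬ IsF T × ¬ IsF T0 × IsConnSum T Δ T0 O T'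

Irreducible : ∀ {n} → Trinity n → Set
Irreducible T = ¬ IsF T × ¬ NontrivialConnSum T

data PlanarOrToric {n : ℕ} (T : Trinity n) : Maybe (Fin n) → Set where
  planar : (O : Fin n) → IsSpherical T → PlanarOrToric T (just O)
  toric  : IsToroidal T → PlanarOrToric T nothing

-- States and clock moves.  `out` is the outer white triangle (planar) or
-- nothing (toric).  A state matches each non-outer white triangle W with
-- one of its vertices, recorded by the colour of that vertex.

Coloring : ℕ → Set
Coloring n = Fin n → Color

notOuter : ∀ {n} → Maybe (Fin n) → Fin n → Set
notOuter nothing  W = ⊤
notOuter (just O) W = O ≢ W

-- the k-vertex represented by black Δ is a root (vertex of the outer triangle)
isRoot : ∀ {n} → Trinity n → Maybe (Fin n) → Color → Fin n → Set
isRoot T nothing  k Δ = ⊥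
isRoot T (just O) k Δ = SameVertex T k (cornerRep T O k) Δ

module States {n : ℕ} (T : Trinity n) (out : Maybe (Fin n)) where

  NotOuter : Fin n → Set
  NotOuter W = notOuter out W

  IsRoot : Color → Fin n → Set
  IsRoot k Δ = isRoot T out k Δ

  IsState : Coloring n → Set
  IsState s =
    (∀ W → NotOuter W → ¬ IsRoot (s W) (cornerRep T W (s W)))
    × (∀ W W' → NotOuter W → NotOuter W' → s W ≡ s W' →
       SameVertex T (s W) (cornerRep T W (s W)) (cornerRep T W' (s W')) → W ≡ W')
    × (∀ k Δ → ¬ IsRoot k Δ →
       ∃ λ W → NotOuter W × s W ≡ k × SameVertex T k (cornerRep T W k) Δ)

  _≈_ : Coloring n → Coloring n → Set
  s ≈ t = ∀ W → NotOuter W → s W ≡ t W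

  Matches : Coloring n → Fin n → Color → Set
  Matches s W k = NotOuter W × s W ≡ k

  -- black Δ has vertices u1 = blue, u2 = green, u3 = red clockwise;
  -- W1 (side u1u2) = toW red Δ, W2 (side u2u3) = toW blue Δ,
  -- W3 (side u3u1) = toW green Δ.
  ClockwiseEmpty : Coloring n → Fin n → Set
  ClockwiseEmpty s Δ = Matches s (toW T red Δ) green × Matches s (toW T blue Δ) red
                       × Matches s (toW T green Δ) blue

  CounterClockwiseEmpty : Coloring n → Fin n → Set
  CounterClockwiseEmpty s Δ = Matches s (toW T red Δ) blue × Matches s (toW T blue Δ) green
                              × Matches s (toW T green Δ) red

  CWMove : Fin n → Coloring n → Coloring n → Set
  CWMove Δ s t = ClockwiseEmpty s Δ × CounterClockwiseEmpty t Δ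
                 × (∀ W → NotOuter W → (∀ c → W ≢ toW T c Δ) → t W ≡ s W)

  data CWPath : Coloring n → Coloring n → Set where
    done : ∀ {s t} → s ≈ t → CWPath s t
    step : ∀ {s s' t} (Δ : Fin n) → CWMove Δ s s' → CWPath s' t → CWPath s t

  changes : ∀ {s t} → CWPath s t → Fin n → ℕ
  changes (done _) Δ' = 0
  changes (step Δ _ p) Δ' with Δ ≟ Δ'
  ... | yes _ = suc (changes p Δ')
  ... | no _  = changes p Δ'

  -- undirected edges of the state transition graph (plus ≈, since a state
  -- is a coloring up to its values on non-outer white triangles)
  Link : Coloring n → Coloring n → Set
  Link s t = s ≈ t ⊎ (∃ λ Δ → CWMove Δ s t) ⊎ (∃ λ Δ → CWMove Δ t s)

  InComponent : Coloring n → Coloring n → Set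
  InComponent s t = IsState t × Star Link s t

  Recurrent : Coloring n → Set
  Recurrent s = ∃ λ Δ → ∃ λ s' → CWMove Δ s s' × CWPath s' s

  Acyclic : Coloring n → Set
  Acyclic s = ∀ t → InComponent s t → ¬ Recurrent t

  NoCCWMove : Coloring n → Set
  NoCCWMove a = ∀ Δ → ¬ CounterClockwiseEmpty a Δ

  -- φ_s = f : f counts how often each black triangle is changed in a
  -- sequence of clockwise moves from the state a (admitting no
  -- counter-clockwise move) of the component to s.
  IsPhi : Coloring n → (Fin n → ℕ) → Set
  IsPhi s f = Σ (Coloring n) λ a → IsState a × NoCCWMove a ×
              Σ (CWPath a s) λ p → ∀ Δ → changes p Δ ≡ f Δ

module Submission where

-- Everything rests on a local description of
-- runs (run-local, count-local): along a valid run a white triangle W only advances its colour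
-- cyclically, one step per move touching W, and which black triangle performs the j-th move at W
-- depends on j alone.  Thus a run is governed by its "heights", the numbers of moves touching each
-- white triangle, and these behave like a lattice:
--   * filtering a run, keeping the j-th move at Δ only for j in a window [e Δ, g Δ), gives a valid
--     run whose heights are clamped (Filtering); suitable windows realise the pointwise minimum
--     (meet-run) and maximum (join-run) of the move counts of two runs from a common state;
--   * reversing runs swaps the two directions, so joins of counter-clockwise runs give common lower
--     bounds, first of two states, then along the whole component (component-lower-bound); hence
--     the state without counter-clockwise moves is the unique base of the component (base-unique).
-- Finally clockwise moves preserve the state conditions (move-preserves-state, a geometric argument
-- on vertex cycles), so the runs produced stay in the component.  The theorem combines these facts.

open import Defs
open import Data.Nat using (ℕ; zero; suc; _+_; _*_; _≤_; _<_; _⊓_; _⊔_; z≤n; s≤s; _≤?_; _<?_)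
open import Data.Nat.Properties hiding (_≟_)
open import Data.Fin using (Fin; toℕ; _≟_)
open import Data.Fin.Properties using (pigeonhole)
open import Data.Fin.Permutation using (inverseˡ; inverseʳ)
open import Data.List using (List; []; _∷_; _++_; [_]; reverse)
open import Data.List.Properties using (unfold-reverse)
open import Data.Maybe using (Maybe; just; nothing)
open import Data.Product using (Σ; ∃; _×_; _,_; proj₁; proj₂)
open import Data.Sum using (_⊎_; inj₁; inj₂)
open import Data.Unit using (⊤; tt)
open import Data.Empty using (⊥-elim)
open import Relation.Nullary using (¬_; Dec; yes; no)
open import Relation.Nullary.Decidable using (_×-dec_)
open import Relation.Binary.Construct.Closure.ReflexiveTransitive as Star using (Star; ε; _◅_; _◅◅_)
open import Relation.Binary.PropositionalEquality hiding ([_])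

data Dir : Set where
  cw ccw : Dir

opposite : Dir → Dir
opposite cw = ccw
opposite ccw = cw

opposite-opposite : ∀ d → opposite (opposite d) ≡ d
opposite-opposite cw = refl
opposite-opposite ccw = refl

-- needs d c: the colour to which the white triangle across the side of Δ opposite its c-corner
-- must be matched for Δ to be d-empty (ClockwiseEmpty / CounterClockwiseEmpty).
needs : Dir → Color → Color
needs cw = next
needs ccw = prev

-- advance d k: the new match of a white triangle matched to k, after a d-move touching it.
advance : Dir → Color → Color
advance cw = next
advance ccw = prev

-- sideFor d k: a white triangle matched to k takes part in a d-move only across the side opposite
-- the (sideFor d k)-corner of the moving black triangle.
sideFor : Dir → Color → Color
sideFor cw = prev
sideFor ccw = next

sideFor-needs : ∀ d c → sideFor d (needs d c) ≡ c
sideFor-needs cw red = refl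
sideFor-needs cw green = refl
sideFor-needs cw blue = refl
sideFor-needs ccw red = refl
sideFor-needs ccw green = refl
sideFor-needs ccw blue = refl

-- After a d-move the triangle is empty for the opposite direction: each side has advanced once.
needs-opposite : ∀ d c → needs (opposite d) c ≡ advance d (needs d c)
needs-opposite cw red = refl
needs-opposite cw green = refl
needs-opposite cw blue = refl
needs-opposite ccw red = refl
needs-opposite ccw green = refl
needs-opposite ccw blue = refl

needs-injective : ∀ d {c c'} → needs d c ≡ needs d c' → c ≡ c'
needs-injective d {c} {c'} e =
  trans (sym (sideFor-needs d c)) (trans (cong (sideFor d) e) (sideFor-needs d c'))

next-prev : ∀ k → next (prev k) ≡ k
next-prev red = refl
next-prev green = refl
next-prev blue = refl

prev-next : ∀ k → prev (next k) ≡ k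
prev-next red = refl
prev-next green = refl
prev-next blue = refl

iter-comm : ∀ {A : Set} (f : A → A) m x → iter f m (f x) ≡ f (iter f m x)
iter-comm f zero x = refl
iter-comm f (suc m) x = cong f (iter-comm f m x)

iter-+ : ∀ {A : Set} (f : A → A) m p x → iter f (m + p) x ≡ iter f m (iter f p x)
iter-+ f zero p x = refl
iter-+ f (suc m) p x = cong f (iter-+ f m p x)

indicator : ∀ {P : Set} → Dec P → ℕ
indicator (yes _) = 1
indicator (no _) = 0

indicator-yes : ∀ {P : Set} (p? : Dec P) → P → indicator p? ≡ 1
indicator-yes (yes _) _ = refl
indicator-yes (no ¬p) p = ⊥-elim (¬p p)

indicator-no : ∀ {P : Set} (p? : Dec P) → ¬ P → indicator p? ≡ 0
indicator-no (yes p) ¬p = ⊥-elim (¬p p)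
indicator-no (no _) _ = refl

InWindow : ℕ → ℕ → ℕ → Set
InWindow e g j = e ≤ j × j < g

inWindow? : ∀ e g j → Dec (InWindow e g j)
inWindow? e g j = (e ≤? j) ×-dec (j <? g)

outside-window : ∀ {e g j} → ¬ InWindow e g j → j < e ⊎ g ≤ j
outside-window {e} {g} {j} out with e ≤? j
... | no e≰j = inj₁ (≰⇒> e≰j)
... | yes e≤j = inj₂ (≮⇒≥ (λ j<g → out (e≤j , j<g)))

windowCount : ℕ → ℕ → ℕ → ℕ → ℕ
windowCount e g j zero = 0
windowCount e g j (suc c) = indicator (inWindow? e g j) + windowCount e g (suc j) c

windowCount-split : ∀ e g j c₁ c₂ →
  windowCount e g j (c₁ + c₂) ≡ windowCount e g j c₁ + windowCount e g (j + c₁) c₂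
windowCount-split e g j zero c₂ rewrite +-identityʳ j = refl
windowCount-split e g j (suc c₁) c₂ rewrite windowCount-split e g (suc j) c₁ c₂ | +-suc j c₁ =
  sym (+-assoc (indicator (inWindow? e g j)) _ _)

windowCount-above : ∀ e g j c → g ≤ j → windowCount e g j c ≡ 0
windowCount-above e g j zero g≤j = refl
windowCount-above e g j (suc c) g≤j
  rewrite indicator-no (inWindow? e g j) (λ w → <⇒≱ (proj₂ w) g≤j) =
  windowCount-above e g (suc j) c (m≤n⇒m≤1+n g≤j)

windowCount-below : ∀ e g j c → j + c ≤ e → windowCount e g j c ≡ 0
windowCount-below e g j zero le = refl
windowCount-below e g j (suc c) le
  rewrite indicator-no (inWindow? e g j)
            (λ w → <⇒≱ (≤-trans (s≤s (m≤m+n j c)) (subst (_≤ e) (+-suc j c) le)) (proj₁ w)) =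
  windowCount-below e g (suc j) c le′
  where
  le′ : suc j + c ≤ e
  le′ = subst (_≤ e) (+-suc j c) le

windowCount-inside : ∀ e g j c → e ≤ j → j + c ≤ g → windowCount e g j c ≡ c
windowCount-inside e g j zero e≤j le = refl
windowCount-inside e g j (suc c) e≤j le
  rewrite indicator-yes (inWindow? e g j) (e≤j , ≤-trans (s≤s (m≤m+n j c)) (subst (_≤ g) (+-suc j c) le)) =
  cong suc (windowCount-inside e g (suc j) c (m≤n⇒m≤1+n e≤j) le′)
  where
  le′ : suc j + c ≤ g
  le′ = subst (_≤ g) (+-suc j c) le

windowCount-min : ∀ c g → windowCount 0 g 0 c ≡ c ⊓ g
windowCount-min c g with ≤-total c g
... | inj₁ c≤g = trans (windowCount-inside 0 g 0 c z≤n c≤g) (sym (m≤n⇒m⊓n≡m c≤g))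
... | inj₂ g≤c with m≤n⇒∃[o]m+o≡n g≤c
...   | o , refl = begin
  windowCount 0 g 0 (g + o)                      ≡⟨ windowCount-split 0 g 0 g o ⟩
  windowCount 0 g 0 g + windowCount 0 g g o      ≡⟨ cong₂ _+_ (windowCount-inside 0 g 0 g z≤n ≤-refl)
                                                              (windowCount-above 0 g g o ≤-refl) ⟩
  g + 0                                          ≡⟨ +-identityʳ g ⟩
  g                                              ≡⟨ sym (m≥n⇒m⊓n≡n g≤c) ⟩
  (g + o) ⊓ g                                    ∎
  where open ≡-Reasoning

windowCount-max : ∀ f g → f + windowCount f g 0 g ≡ f ⊔ g
windowCount-max f g with ≤-total f g
... | inj₂ g≤f = begin
  f + windowCount f g 0 g   ≡⟨ cong (f +_) (windowCount-below f g 0 g g≤f) ⟩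
  f + 0                     ≡⟨ +-identityʳ f ⟩
  f                         ≡⟨ sym (m≥n⇒m⊔n≡m g≤f) ⟩
  f ⊔ g                     ∎
  where open ≡-Reasoning
... | inj₁ f≤g with m≤n⇒∃[o]m+o≡n f≤g
...   | o , refl = begin
  f + windowCount f (f + o) 0 (f + o)
    ≡⟨ cong (f +_) (windowCount-split f (f + o) 0 f o) ⟩
  f + (windowCount f (f + o) 0 f + windowCount f (f + o) f o)
    ≡⟨ cong (f +_) (cong₂ _+_ (windowCount-below f (f + o) 0 f ≤-refl)
                              (windowCount-inside f (f + o) f o ≤-refl ≤-refl)) ⟩
  f + o
    ≡⟨ sym (m≤n⇒m⊔n≡n f≤g) ⟩
  f ⊔ (f + o) ∎
  where open ≡-Reasoning

clamp : ℕ → ℕ → ℕ → ℕ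
clamp lo hi L = lo ⊔ (L ⊓ hi)

clamp-inside : ∀ {lo hi L} → lo ≤ L → L ≤ hi → clamp lo hi L ≡ L
clamp-inside {lo} {hi} {L} lo≤L L≤hi rewrite m≤n⇒m⊓n≡m L≤hi = m≤n⇒m⊔n≡n lo≤L

clamp-step-in : ∀ {lo hi L} → InWindow lo hi L → clamp lo hi (suc L) ≡ suc (clamp lo hi L)
clamp-step-in (lo≤L , L<hi) =
  trans (clamp-inside (m≤n⇒m≤1+n lo≤L) L<hi) (cong suc (sym (clamp-inside lo≤L (<⇒≤ L<hi))))

clamp-step-out : ∀ {lo hi L} → ¬ InWindow lo hi L → clamp lo hi (suc L) ≡ clamp lo hi L
clamp-step-out {lo} {hi} {L} out with outside-window out
... | inj₁ L<lo = trans (m≥n⇒m⊔n≡m (≤-trans (m⊓n≤m (suc L) hi) L<lo))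
                        (sym (m≥n⇒m⊔n≡m (≤-trans (m⊓n≤m L hi) (<⇒≤ L<lo))))
... | inj₂ hi≤L = cong (lo ⊔_) (trans (m≥n⇒m⊓n≡n (m≤n⇒m≤1+n hi≤L)) (sym (m≥n⇒m⊓n≡n hi≤L)))

module _ (h : ℕ → ℕ) (mono : ∀ {i j} → i ≤ j → h i ≤ h j) {L : ℕ} (jump : h (suc L) ≡ suc (h L)) where

  window-reflect : ∀ {lo hi} → InWindow (h lo) (h hi) (h L) → InWindow lo hi L
  window-reflect {lo} (hlo≤hL , hL<hhi) =
    ≮⇒≥ (λ L<lo → <⇒≱ (subst (_≤ h lo) jump (mono L<lo)) hlo≤hL) ,
    ≰⇒> (λ hi≤L → <⇒≱ hL<hhi (mono hi≤L))

  window-preserve : ∀ {lo hi} → InWindow lo hi L → InWindow (h lo) (h hi) (h L)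
  window-preserve {hi = hi} (lo≤L , L<hi) = mono lo≤L , subst (_≤ h hi) jump (mono L<hi)

sideIndicator : Maybe Color → ℕ
sideIndicator (just _) = 1
sideIndicator nothing = 0

module Runs {n : ℕ} (T : Trinity n) (out : Maybe (Fin n)) where
  open States T out

  w b : Color → Fin n → Fin n
  w = toW T
  b = toB T

  b-w : ∀ c Δ → b c (w c Δ) ≡ Δ
  b-w c Δ = inverseˡ (adj T c)

  w-b : ∀ c W → w c (b c W) ≡ W
  w-b c W = inverseʳ (adj T c)

  whichSide : Fin n → Fin n → Maybe Color
  whichSide Δ W with W ≟ w red Δ
  ... | yes _ = just red
  ... | no _ with W ≟ w blue Δ
  ...   | yes _ = just blue
  ...   | no _ with W ≟ w green Δ
  ...     | yes _ = just green
  ...     | no _ = nothing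

  whichSide-just : ∀ Δ W {c} → whichSide Δ W ≡ just c → W ≡ w c Δ
  whichSide-just Δ W e with W ≟ w red Δ
  whichSide-just Δ W refl | yes p = p
  ... | no _ with W ≟ w blue Δ
  whichSide-just Δ W refl | no _ | yes p = p
  ... | no _ with W ≟ w green Δ
  whichSide-just Δ W refl | no _ | no _ | yes p = p
  whichSide-just Δ W () | no _ | no _ | no _

  whichSide-nothing : ∀ Δ W → whichSide Δ W ≡ nothing → ∀ c → W ≢ w c Δ
  whichSide-nothing Δ W e c with W ≟ w red Δ
  whichSide-nothing Δ W () c | yes p
  ... | no p₁ with W ≟ w blue Δ
  whichSide-nothing Δ W () c | no p₁ | yes p
  ... | no p₂ with W ≟ w green Δ
  whichSide-nothing Δ W () c | no p₁ | no p₂ | yes p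
  whichSide-nothing Δ W e red | no p₁ | no p₂ | no p₃ = p₁
  whichSide-nothing Δ W e green | no p₁ | no p₂ | no p₃ = p₃
  whichSide-nothing Δ W e blue | no p₁ | no p₂ | no p₃ = p₂

  whichSide-view : ∀ Δ W → (∃ λ c → whichSide Δ W ≡ just c) ⊎ whichSide Δ W ≡ nothing
  whichSide-view Δ W with whichSide Δ W
  ... | just c = inj₁ (c , refl)
  ... | nothing = inj₂ refl

  whichSide-none : ∀ Δ W → (∀ c → W ≢ w c Δ) → whichSide Δ W ≡ nothing
  whichSide-none Δ W off with whichSide-view Δ W
  ... | inj₁ (c , eq) = ⊥-elim (off c (whichSide-just Δ W eq))
  ... | inj₂ eq = eq

  Touches : Fin n → Fin n → Set
  Touches Δ W = ∃ λ c → whichSide Δ W ≡ just c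

  record Empty (d : Dir) (σ : Coloring n) (Δ : Fin n) : Set where
    constructor sidesMatch
    field
      side : ∀ c → NotOuter (w c Δ) × σ (w c Δ) ≡ needs d c
  open Empty

  -- the three sides of an empty triangle are distinct, so whichSide finds each of them
  whichSide-empty : ∀ {d σ Δ} → Empty d σ Δ → ∀ c → whichSide Δ (w c Δ) ≡ just c
  whichSide-empty {d} {σ} {Δ} E c with whichSide Δ (w c Δ) in eq
  ... | just c' = cong just (needs-injective d
          (trans (sym (proj₂ (side E c'))) (trans (cong σ (sym (whichSide-just Δ (w c Δ) eq))) (proj₂ (side E c)))))
  ... | nothing = ⊥-elim (whichSide-nothing Δ (w c Δ) eq c refl)

  recolour : Dir → Color → Maybe Color → Color
  recolour d k (just c) = needs (opposite d) c
  recolour d k nothing = k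

  move : Dir → Fin n → Coloring n → Coloring n
  move d Δ σ W = recolour d (σ W) (whichSide Δ W)

  move-just : ∀ d Δ σ W {c} → whichSide Δ W ≡ just c → move d Δ σ W ≡ needs (opposite d) c
  move-just d Δ σ W e rewrite e = refl

  move-nothing : ∀ d Δ σ W → whichSide Δ W ≡ nothing → move d Δ σ W ≡ σ W
  move-nothing d Δ σ W e rewrite e = refl

  touched-needs : ∀ {d σ Δ c} W → Empty d σ Δ → whichSide Δ W ≡ just c → σ W ≡ needs d c
  touched-needs {σ = σ} {Δ} W E eq = trans (cong σ (whichSide-just Δ W eq)) (proj₂ (side E _))

  touched-mover : ∀ {d σ Δ c} W → Empty d σ Δ → whichSide Δ W ≡ just c → b (sideFor d (σ W)) W ≡ Δ
  touched-mover {d} {σ} {Δ} {c} W E eq = begin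
    b (sideFor d (σ W)) W       ≡⟨ cong (λ k → b (sideFor d k) W) (touched-needs W E eq) ⟩
    b (sideFor d (needs d c)) W ≡⟨ cong (λ k → b k W) (sideFor-needs d c) ⟩
    b c W                       ≡⟨ cong (b c) (whichSide-just Δ W eq) ⟩
    b c (w c Δ)                 ≡⟨ b-w c Δ ⟩
    Δ                           ∎
    where open ≡-Reasoning

  touched-advance : ∀ {d σ Δ c} W → Empty d σ Δ → whichSide Δ W ≡ just c →
                    move d Δ σ W ≡ advance d (σ W)
  touched-advance {d} {σ} {Δ} {c} W E eq =
    trans (move-just d Δ σ W eq) (trans (needs-opposite d c) (cong (advance d) (sym (touched-needs W E eq))))

  Valid : Dir → Coloring n → List (Fin n) → Set
  Valid d σ [] = ⊤
  Valid d σ (Δ ∷ ds) = Empty d σ Δ × Valid d (move d Δ σ) ds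

  run : Dir → Coloring n → List (Fin n) → Coloring n
  run d σ [] = σ
  run d σ (Δ ∷ ds) = run d (move d Δ σ) ds

  run-++ : ∀ d σ ds es → run d σ (ds ++ es) ≡ run d (run d σ ds) es
  run-++ d σ [] es = refl
  run-++ d σ (Δ ∷ ds) es = run-++ d (move d Δ σ) ds es

  valid-++ : ∀ d σ ds es → Valid d σ ds → Valid d (run d σ ds) es → Valid d σ (ds ++ es)
  valid-++ d σ [] es _ v = v
  valid-++ d σ (Δ ∷ ds) es (E , v) v' = E , valid-++ d (move d Δ σ) ds es v v'

  ≈-refl : ∀ {σ} → σ ≈ σ
  ≈-refl W _ = refl

  ≈-sym : ∀ {σ τ} → σ ≈ τ → τ ≈ σ
  ≈-sym e W o = sym (e W o)

  ≈-trans : ∀ {σ τ ρ} → σ ≈ τ → τ ≈ ρ → σ ≈ ρ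
  ≈-trans e f W o = trans (e W o) (f W o)

  empty-≈ : ∀ d {σ τ} Δ → σ ≈ τ → Empty d σ Δ → Empty d τ Δ
  empty-≈ d Δ e E = sidesMatch λ c → proj₁ (side E c) , trans (sym (e _ (proj₁ (side E c)))) (proj₂ (side E c))

  move-≈ : ∀ d Δ {σ τ} → σ ≈ τ → move d Δ σ ≈ move d Δ τ
  move-≈ d Δ e W o with whichSide Δ W
  ... | just c = refl
  ... | nothing = e W o

  valid-≈ : ∀ d {σ τ} ds → σ ≈ τ → Valid d σ ds → Valid d τ ds
  valid-≈ d [] e v = tt
  valid-≈ d (Δ ∷ ds) e (E , v) = empty-≈ d Δ e E , valid-≈ d ds (move-≈ d Δ e) v

  run-≈ : ∀ d {σ τ} ds → σ ≈ τ → run d σ ds ≈ run d τ ds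
  run-≈ d [] e = e
  run-≈ d (Δ ∷ ds) e = run-≈ d ds (move-≈ d Δ e)

  move-empties-opposite : ∀ d σ Δ → Empty d σ Δ → Empty (opposite d) (move d Δ σ) Δ
  move-empties-opposite d σ Δ E = sidesMatch λ c → proj₁ (side E c) , move-just d Δ σ (w c Δ) (whichSide-empty E c)

  move-undo : ∀ d σ Δ → Empty d σ Δ → move (opposite d) Δ (move d Δ σ) ≈ σ
  move-undo d σ Δ E W o with whichSide Δ W in eq
  ... | just c = trans (cong (λ d' → needs d' c) (opposite-opposite d)) (sym (touched-needs W E eq))
  ... | nothing = refl

  reverse-run : ∀ d σ ds → Valid d σ ds →
    Valid (opposite d) (run d σ ds) (reverse ds) × run (opposite d) (run d σ ds) (reverse ds) ≈ σ
  reverse-run d σ [] v = tt , ≈-refl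
  reverse-run d σ (Δ ∷ ds) (E , v) rewrite unfold-reverse Δ ds with reverse-run d (move d Δ σ) ds v
  ... | v' , back =
    valid-++ (opposite d) _ (reverse ds) [ Δ ] v'
      (empty-≈ (opposite d) Δ (≈-sym back) (move-empties-opposite d σ Δ E) , tt) ,
    subst (_≈ σ) (sym (run-++ (opposite d) _ (reverse ds) [ Δ ]))
      (≈-trans (move-≈ (opposite d) Δ back) (move-undo d σ Δ E))

  -- Local description of a run at a white triangle

  count : List (Fin n) → Fin n → ℕ
  count [] Δ = 0
  count (Δ' ∷ ds) Δ = indicator (Δ' ≟ Δ) + count ds Δ

  count-here : ∀ Δ ds → count (Δ ∷ ds) Δ ≡ suc (count ds Δ)
  count-here Δ ds = cong (_+ count ds Δ) (indicator-yes (Δ ≟ Δ) refl)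

  count-elsewhere : ∀ {Δ' Δ} ds → Δ' ≢ Δ → count (Δ' ∷ ds) Δ ≡ count ds Δ
  count-elsewhere {Δ'} {Δ} ds ne = cong (_+ count ds Δ) (indicator-no (Δ' ≟ Δ) ne)

  count-++ : ∀ ds es Δ → count (ds ++ es) Δ ≡ count ds Δ + count es Δ
  count-++ [] es Δ = refl
  count-++ (Δ' ∷ ds) es Δ =
    trans (cong (indicator (Δ' ≟ Δ) +_) (count-++ ds es Δ)) (sym (+-assoc (indicator (Δ' ≟ Δ)) _ _))

  -- the height of W after a run: the number of its moves touching W
  touches : List (Fin n) → Fin n → ℕ
  touches [] W = 0
  touches (Δ ∷ ds) W = sideIndicator (whichSide Δ W) + touches ds W

  run-local : ∀ d σ ds → Valid d σ ds → ∀ W → run d σ ds W ≡ iter (advance d) (touches ds W) (σ W)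
  run-local d σ [] v W = refl
  run-local d σ (Δ ∷ ds) (E , v) W with whichSide Δ W in eq
  ... | just c = trans (run-local d (move d Δ σ) ds v W)
        (trans (cong (iter (advance d) (touches ds W)) (touched-advance W E eq))
               (iter-comm (advance d) (touches ds W) (σ W)))
  ... | nothing = trans (run-local d (move d Δ σ) ds v W)
        (cong (iter (advance d) (touches ds W)) (move-nothing d Δ σ W eq))

  -- mover d W k j: the black triangle performing the j-th d-move touching W, if W starts matched to k
  mover : Dir → Fin n → Color → ℕ → Fin n
  mover d W k j = b (sideFor d (iter (advance d) j k)) W

  moverCount : Dir → Fin n → Color → ℕ → Fin n → ℕ
  moverCount d W k zero Δ = 0
  moverCount d W k (suc L) Δ = moverCount d W k L Δ + indicator (mover d W k L ≟ Δ)

  moverCount-mono : ∀ d W k Δ {i j} → i ≤ j → moverCount d W k i Δ ≤ moverCount d W k j Δ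
  moverCount-mono d W k Δ {j = zero} z≤n = ≤-refl
  moverCount-mono d W k Δ {j = suc j} i≤1+j with m≤n⇒m<n∨m≡n i≤1+j
  ... | inj₂ refl = ≤-refl
  ... | inj₁ i<1+j = ≤-trans (moverCount-mono d W k Δ (≤-pred i<1+j)) (m≤m+n _ _)

  moverCount-jump : ∀ d W k L Δ → mover d W k L ≡ Δ → moverCount d W k (suc L) Δ ≡ suc (moverCount d W k L Δ)
  moverCount-jump d W k L Δ here =
    trans (cong (moverCount d W k L Δ +_) (indicator-yes (mover d W k L ≟ Δ) here)) (+-comm _ 1)

  moverCount-skip : ∀ d W k L Δ → mover d W k L ≢ Δ → moverCount d W k (suc L) Δ ≡ moverCount d W k L Δ
  moverCount-skip d W k L Δ there =
    trans (cong (moverCount d W k L Δ +_) (indicator-no (mover d W k L ≟ Δ) there)) (+-identityʳ _)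

  moverCount-first : ∀ d W k L Δ →
    moverCount d W k (suc L) Δ ≡ indicator (mover d W k 0 ≟ Δ) + moverCount d W (advance d k) L Δ
  moverCount-first d W k zero Δ = sym (+-identityʳ _)
  moverCount-first d W k (suc L) Δ = begin
    moverCount d W k (suc L) Δ + indicator (mover d W k (suc L) ≟ Δ)
      ≡⟨ cong₂ _+_ (moverCount-first d W k L Δ)
                   (cong (λ Δ' → indicator (Δ' ≟ Δ)) (cong (λ k' → b (sideFor d k') W)
                     (sym (iter-comm (advance d) L k)))) ⟩
    (first + moverCount d W (advance d k) L Δ) + indicator (mover d W (advance d k) L ≟ Δ)
      ≡⟨ +-assoc first _ _ ⟩
    first + moverCount d W (advance d k) (suc L) Δ ∎
    where
    open ≡-Reasoning
    first = indicator (mover d W k 0 ≟ Δ)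

  count-local : ∀ d σ ds → Valid d σ ds → ∀ W Δ → Touches Δ W →
                count ds Δ ≡ moverCount d W (σ W) (touches ds W) Δ
  count-local d σ [] v W Δ t = refl
  count-local d σ (Δ' ∷ ds) (E , v) W Δ t with whichSide Δ' W in eq
  ... | just c = begin
    indicator (Δ' ≟ Δ) + count ds Δ
      ≡⟨ cong₂ _+_ (cong (λ Δ'' → indicator (Δ'' ≟ Δ)) (sym (touched-mover W E eq)))
                   (count-local d (move d Δ' σ) ds v W Δ t) ⟩
    indicator (mover d W (σ W) 0 ≟ Δ) + moverCount d W (move d Δ' σ W) (touches ds W) Δ
      ≡⟨ cong (λ k → indicator (mover d W (σ W) 0 ≟ Δ) + moverCount d W k (touches ds W) Δ)
              (touched-advance W E eq) ⟩
    indicator (mover d W (σ W) 0 ≟ Δ) + moverCount d W (advance d (σ W)) (touches ds W) Δ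
      ≡⟨ sym (moverCount-first d W (σ W) (touches ds W) Δ) ⟩
    moverCount d W (σ W) (suc (touches ds W)) Δ ∎
    where open ≡-Reasoning
  ... | nothing = trans (count-elsewhere ds elsewhere)
        (trans (count-local d (move d Δ' σ) ds v W Δ t)
               (cong (λ k → moverCount d W k (touches ds W) Δ) (move-nothing d Δ' σ W eq)))
    where
    elsewhere : Δ' ≢ Δ
    elsewhere refl with trans (sym (proj₂ t)) eq
    ... | ()

  -- Filtering a run through windows

  bump : (Fin n → ℕ) → Fin n → Fin n → ℕ
  bump k Δ Δ' = indicator (Δ ≟ Δ') + k Δ'

  filterWindow : (e g : Fin n → ℕ) → (Fin n → ℕ) → List (Fin n) → List (Fin n)
  filterWindow e g k [] = []
  filterWindow e g k (Δ ∷ ds) with inWindow? (e Δ) (g Δ) (k Δ)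
  ... | yes _ = Δ ∷ filterWindow e g (bump k Δ) ds
  ... | no _ = filterWindow e g (bump k Δ) ds

  count-filterWindow-head : ∀ e g k Δ ds → count (filterWindow e g k (Δ ∷ ds)) Δ ≡
    indicator (inWindow? (e Δ) (g Δ) (k Δ)) + count (filterWindow e g (bump k Δ) ds) Δ
  count-filterWindow-head e g k Δ ds with inWindow? (e Δ) (g Δ) (k Δ)
  ... | yes _ = count-here Δ (filterWindow e g (bump k Δ) ds)
  ... | no _ = refl

  count-filterWindow-elsewhere : ∀ e g k {Δ' Δ} ds → Δ' ≢ Δ →
    count (filterWindow e g k (Δ' ∷ ds)) Δ ≡ count (filterWindow e g (bump k Δ') ds) Δ
  count-filterWindow-elsewhere e g k {Δ'} ds ne with inWindow? (e Δ') (g Δ') (k Δ')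
  ... | yes _ = count-elsewhere (filterWindow e g (bump k Δ') ds) ne
  ... | no _ = refl

  count-filterWindow : ∀ e g k ds Δ →
    count (filterWindow e g k ds) Δ ≡ windowCount (e Δ) (g Δ) (k Δ) (count ds Δ)
  count-filterWindow e g k [] Δ = refl
  count-filterWindow e g k (Δ' ∷ ds) Δ with Δ' ≟ Δ
  ... | yes refl = begin
    count (filterWindow e g k (Δ' ∷ ds)) Δ'
      ≡⟨ count-filterWindow-head e g k Δ' ds ⟩
    indicator (inWindow? (e Δ') (g Δ') (k Δ')) + count (filterWindow e g (bump k Δ') ds) Δ'
      ≡⟨ cong (_ +_) (count-filterWindow e g (bump k Δ') ds Δ') ⟩
    indicator (inWindow? (e Δ') (g Δ') (k Δ')) + windowCount (e Δ') (g Δ') (bump k Δ' Δ') (count ds Δ')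
      ≡⟨ cong (λ j → indicator (inWindow? (e Δ') (g Δ') (k Δ')) + windowCount (e Δ') (g Δ') j (count ds Δ'))
              (cong (_+ k Δ') (indicator-yes (Δ' ≟ Δ') refl)) ⟩
    windowCount (e Δ') (g Δ') (k Δ') (suc (count ds Δ')) ∎
    where open ≡-Reasoning
  ... | no ne = begin
    count (filterWindow e g k (Δ' ∷ ds)) Δ
      ≡⟨ count-filterWindow-elsewhere e g k ds ne ⟩
    count (filterWindow e g (bump k Δ') ds) Δ
      ≡⟨ count-filterWindow e g (bump k Δ') ds Δ ⟩
    windowCount (e Δ) (g Δ) (bump k Δ' Δ) (count ds Δ)
      ≡⟨ cong (λ j → windowCount (e Δ) (g Δ) j (count ds Δ)) (cong (_+ k Δ) (indicator-no (Δ' ≟ Δ) ne)) ⟩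
    windowCount (e Δ) (g Δ) (k Δ) (count ds Δ) ∎
    where open ≡-Reasoning

  -- Fix a start a and two "virtual runs" from a given by their move counts e, g and heights Le, Lg,
  -- related as in count-local.  Walking along a valid run ds from a and keeping the moves inside the
  -- windows [e, g) gives a valid run from the state at heights Le, ending at the clamped heights.
  module Filtering (d : Dir) (a : Coloring n) (e g Le Lg : Fin n → ℕ)
     (e-local : ∀ W Δ → Touches Δ W → e Δ ≡ moverCount d W (a W) (Le W) Δ)
     (g-local : ∀ W Δ → Touches Δ W → g Δ ≡ moverCount d W (a W) (Lg W) Δ) where

    height : ℕ → Fin n → Color
    height m W = iter (advance d) m (a W)

    -- walking invariant: x is the current state of ds at heights L, k counts the moves of ds so far,
    -- and z is the current state of the filtered run, at the clamped heights
    record Walk (x : Coloring n) (k : Fin n → ℕ) (z : Coloring n) (L : Fin n → ℕ) : Set where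
      field
        at-x : ∀ W → x W ≡ height (L W) W
        at-k : ∀ W Δ → Touches Δ W → k Δ ≡ moverCount d W (a W) (L W) Δ
        at-z : ∀ W → z W ≡ height (clamp (Le W) (Lg W) (L W)) W
    open Walk

    walk-heights : ∀ {x k z L L'} → (∀ W → L W ≡ L' W) → Walk x k z L → Walk x k z L'
    walk-heights {x} {k} {z} eq I = record
      { at-x = λ W → subst (λ m → x W ≡ height m W) (eq W) (at-x I W)
      ; at-k = λ W Δ t → subst (λ m → k Δ ≡ moverCount d W (a W) m Δ) (eq W) (at-k I W Δ t)
      ; at-z = λ W → subst (λ m → z W ≡ height (clamp (Le W) (Lg W) m) W) (eq W) (at-z I W) }

    module Step {x k z L Δ} (E : Empty d x Δ) (I : Walk x k z L) where

      L' : Fin n → ℕ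
      L' W = sideIndicator (whichSide Δ W) + L W

      L'-just : ∀ W {c} → whichSide Δ W ≡ just c → L' W ≡ suc (L W)
      L'-just W eq = cong (λ s → sideIndicator s + L W) eq

      L'-nothing : ∀ W → whichSide Δ W ≡ nothing → L' W ≡ L W
      L'-nothing W eq = cong (λ s → sideIndicator s + L W) eq

      next-mover : ∀ W {c} → whichSide Δ W ≡ just c → mover d W (a W) (L W) ≡ Δ
      next-mover W eq = trans (cong (λ k' → b (sideFor d k') W) (sym (at-x I W))) (touched-mover W E eq)

      window-at : ∀ W {c} → whichSide Δ W ≡ just c →
        (InWindow (e Δ) (g Δ) (k Δ) → InWindow (Le W) (Lg W) (L W)) ×
        (InWindow (Le W) (Lg W) (L W) → InWindow (e Δ) (g Δ) (k Δ))
      window-at W {c} eq rewrite e-local W Δ (c , eq) | g-local W Δ (c , eq) | at-k I W Δ (c , eq) =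
        window-reflect h (moverCount-mono d W (a W) Δ) jump ,
        window-preserve h (moverCount-mono d W (a W) Δ) jump
        where
        h : ℕ → ℕ
        h m = moverCount d W (a W) m Δ
        jump : h (suc (L W)) ≡ suc (h (L W))
        jump = moverCount-jump d W (a W) (L W) Δ (next-mover W eq)

      walk-x : ∀ W → move d Δ x W ≡ height (L' W) W
      walk-x W with whichSide-view Δ W
      ... | inj₁ (c , eq) = trans (touched-advance W E eq)
              (trans (cong (advance d) (at-x I W)) (cong (λ m → height m W) (sym (L'-just W eq))))
      ... | inj₂ eq = trans (move-nothing d Δ x W eq)
              (trans (at-x I W) (cong (λ m → height m W) (sym (L'-nothing W eq))))

      walk-k : ∀ W Δ'' → Touches Δ'' W → bump k Δ Δ'' ≡ moverCount d W (a W) (L' W) Δ''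
      walk-k W Δ'' t with whichSide-view Δ W | Δ ≟ Δ''
      ... | inj₁ (c , eq) | yes refl =
            trans (cong suc (at-k I W Δ t))
              (trans (sym (moverCount-jump d W (a W) (L W) Δ (next-mover W eq)))
                (cong (λ m → moverCount d W (a W) m Δ) (sym (L'-just W eq))))
      ... | inj₁ (c , eq) | no ne =
            trans (at-k I W Δ'' t)
              (trans (sym (moverCount-skip d W (a W) (L W) Δ'' (λ p → ne (trans (sym (next-mover W eq)) p))))
                (cong (λ m → moverCount d W (a W) m Δ'') (sym (L'-just W eq))))
      ... | inj₂ eq | yes refl with trans (sym (proj₂ t)) eq
      ...   | ()
      walk-k W Δ'' t | inj₂ eq | no _ =
            trans (at-k I W Δ'' t) (cong (λ m → moverCount d W (a W) m Δ'') (sym (L'-nothing W eq)))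

      kept-side : InWindow (e Δ) (g Δ) (k Δ) → ∀ c → NotOuter (w c Δ) × z (w c Δ) ≡ needs d c
      kept-side inside c = proj₁ (side E c) , (begin
        z (w c Δ)                                              ≡⟨ at-z I (w c Δ) ⟩
        height (clamp (Le (w c Δ)) (Lg (w c Δ)) (L (w c Δ))) _ ≡⟨ cong (λ m → height m (w c Δ))
                                                                   (clamp-inside lo≤L (<⇒≤ L<hi)) ⟩
        height (L (w c Δ)) (w c Δ)                             ≡⟨ sym (at-x I (w c Δ)) ⟩
        x (w c Δ)                                              ≡⟨ proj₂ (side E c) ⟩
        needs d c                                              ∎)
        where
        open ≡-Reasoning
        window : InWindow (Le (w c Δ)) (Lg (w c Δ)) (L (w c Δ))
        window = proj₁ (window-at (w c Δ) (whichSide-empty E c)) inside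
        lo≤L = proj₁ window
        L<hi = proj₂ window

      kept-empty : InWindow (e Δ) (g Δ) (k Δ) → Empty d z Δ
      kept-empty inside = sidesMatch (kept-side inside)

      kept-z : InWindow (e Δ) (g Δ) (k Δ) → ∀ W → move d Δ z W ≡ height (clamp (Le W) (Lg W) (L' W)) W
      kept-z inside W with whichSide-view Δ W
      ... | inj₁ (c , eq) = trans (touched-advance W (kept-empty inside) eq)
              (trans (cong (advance d) (at-z I W))
                (cong (λ m → height m W)
                  (sym (trans (cong (clamp (Le W) (Lg W)) (L'-just W eq))
                              (clamp-step-in (proj₁ (window-at W eq) inside))))))
      ... | inj₂ eq = trans (move-nothing d Δ z W eq)
              (trans (at-z I W) (cong (λ m → height (clamp (Le W) (Lg W) m) W) (sym (L'-nothing W eq))))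

      skipped-z : ¬ InWindow (e Δ) (g Δ) (k Δ) → ∀ W → z W ≡ height (clamp (Le W) (Lg W) (L' W)) W
      skipped-z outside W with whichSide-view Δ W
      ... | inj₁ (c , eq) = trans (at-z I W) (cong (λ m → height m W)
              (sym (trans (cong (clamp (Le W) (Lg W)) (L'-just W eq))
                          (clamp-step-out (λ inside → outside (proj₂ (window-at W eq) inside))))))
      ... | inj₂ eq = trans (at-z I W)
              (cong (λ m → height (clamp (Le W) (Lg W) m) W) (sym (L'-nothing W eq)))

      kept-walk : InWindow (e Δ) (g Δ) (k Δ) → Walk (move d Δ x) (bump k Δ) (move d Δ z) L'
      kept-walk inside = record { at-x = walk-x ; at-k = walk-k ; at-z = kept-z inside }

      skipped-walk : ¬ InWindow (e Δ) (g Δ) (k Δ) → Walk (move d Δ x) (bump k Δ) z L'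
      skipped-walk outside = record { at-x = walk-x ; at-k = walk-k ; at-z = skipped-z outside }

    heights-after : ∀ Δ ds (L : Fin n → ℕ) W →
      (sideIndicator (whichSide Δ W) + L W) + touches ds W ≡ L W + touches (Δ ∷ ds) W
    heights-after Δ ds L W =
      trans (cong (_+ touches ds W) (+-comm (sideIndicator (whichSide Δ W)) (L W))) (+-assoc (L W) _ _)

    filter-run : ∀ ds x k z L → Valid d x ds → Walk x k z L →
       Valid d z (filterWindow e g k ds) ×
       ∃ λ k' → Walk (run d x ds) k' (run d z (filterWindow e g k ds)) (λ W → L W + touches ds W)
    filter-run [] x k z L v I = tt , k , walk-heights (λ W → sym (+-identityʳ (L W))) I
    filter-run (Δ ∷ ds) x k z L (E , v) I with inWindow? (e Δ) (g Δ) (k Δ)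
    ... | yes inside with filter-run ds _ _ _ _ v (Step.kept-walk E I inside)
    ...   | v' , k' , I' = (Step.kept-empty E I inside , v') , k' , walk-heights (heights-after Δ ds L) I'
    filter-run (Δ ∷ ds) x k z L (E , v) I | no outside with filter-run ds _ _ _ _ v (Step.skipped-walk E I outside)
    ...   | v' , k' , I' = v' , k' , walk-heights (heights-after Δ ds L) I'

  meet-run : ∀ d X p q → Valid d X p → Valid d X q → Σ (List (Fin n)) λ F →
             Valid d X F × (∀ Δ → count F Δ ≡ count p Δ ⊓ count q Δ)
  meet-run d X p q vp vq =
    filterWindow zeros (count q) zeros p ,
    proj₁ (filter-run p X zeros X zeros vp start) ,
    λ Δ → trans (count-filterWindow zeros (count q) zeros p Δ) (windowCount-min (count p Δ) (count q Δ))
    where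
    zeros : Fin n → ℕ
    zeros _ = 0
    open Filtering d X zeros (count q) zeros (touches q) (λ _ _ _ → refl) (count-local d X q vq)
    start : Walk X zeros X zeros
    start = record { at-x = λ _ → refl ; at-k = λ _ _ _ → refl ; at-z = λ _ → refl }

  join-run : ∀ d X p q → Valid d X p → Valid d X q → Σ (List (Fin n)) λ F →
             Valid d (run d X p) F ×
             (∀ W → run d (run d X p) F W ≡ iter (advance d) (touches p W ⊔ touches q W) (X W)) ×
             (∀ Δ → count p Δ + count F Δ ≡ count p Δ ⊔ count q Δ)
  join-run d X p q vp vq =
    F , proj₁ walked ,
    (λ W → trans (Walk.at-z (proj₂ (proj₂ walked)) W)
             (cong (λ m → iter (advance d) (touches p W ⊔ m) (X W)) (⊓-idem (touches q W)))) ,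
    λ Δ → trans (cong (count p Δ +_) (count-filterWindow (count p) (count q) zeros q Δ))
                (windowCount-max (count p Δ) (count q Δ))
    where
    zeros : Fin n → ℕ
    zeros _ = 0
    open Filtering d X (count p) (count q) (touches p) (touches q) (count-local d X p vp) (count-local d X q vq)
    start : Walk X zeros (run d X p) zeros
    start = record
      { at-x = λ _ → refl ; at-k = λ _ _ _ → refl
      ; at-z = λ W → trans (run-local d X p vp W)
                 (cong (λ m → iter (advance d) m (X W)) (sym (⊔-identityʳ (touches p W)))) }
    F = filterWindow (count p) (count q) zeros q
    walked = filter-run q X zeros (run d X p) zeros vq start

  -- Lower bounds in a component

  Reaches : Coloring n → Coloring n → Set
  Reaches x y = Σ (List (Fin n)) λ ds → Valid cw x ds × run cw x ds ≈ y

  reaches-≈ʳ : ∀ {x y y'} → Reaches x y → y ≈ y' → Reaches x y'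
  reaches-≈ʳ (ds , v , r) e = ds , v , ≈-trans r e

  reaches-≈ˡ : ∀ {x x' y} → x ≈ x' → Reaches x y → Reaches x' y
  reaches-≈ˡ e (ds , v , r) = ds , valid-≈ cw ds e v , ≈-trans (run-≈ cw ds (≈-sym e)) r

  reaches-trans : ∀ {x y z} → Reaches x y → Reaches y z → Reaches x z
  reaches-trans {x} (ds , v , r) (es , v' , r') =
    ds ++ es , valid-++ cw x ds es v (valid-≈ cw es (≈-sym r) v') ,
    subst (_≈ _) (sym (run-++ cw x ds es)) (≈-trans (run-≈ cw es r) r')

  -- Two states reaching a common state have a common lower bound: reverse both runs and join the
  -- reversed (counter-clockwise) runs; reversing the joining runs leads back to each state.
  common-lower-bound : ∀ {y y' x} → Reaches y x → Reaches y' x → ∃ λ m → Reaches m y × Reaches m y'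
  common-lower-bound {y} {y'} (ds , v , r) (ds' , v' , r') =
    M , (reverse F , proj₁ back , ≈-trans (proj₂ back) (proj₂ rev))
      , reaches-≈ˡ (≈-sym same) (reverse F' , proj₁ back' , ≈-trans (proj₂ back') to-y')
    where
    X : Coloring n
    X = run cw y ds
    X≈ : run cw y' ds' ≈ X
    X≈ = ≈-trans r' (≈-sym r)
    p q : List (Fin n)
    p = reverse ds
    q = reverse ds'
    rev = reverse-run cw y ds v
    rev' = reverse-run cw y' ds' v'
    vq : Valid ccw X q
    vq = valid-≈ ccw q X≈ (proj₁ rev')
    to-y' : run ccw X q ≈ y'
    to-y' = ≈-trans (run-≈ ccw q (≈-sym X≈)) (proj₂ rev')
    joinPQ = join-run ccw X p q (proj₁ rev) vq
    joinQP = join-run ccw X q p vq (proj₁ rev)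
    F F' : List (Fin n)
    F = proj₁ joinPQ
    F' = proj₁ joinQP
    M : Coloring n
    M = run ccw (run ccw X p) F
    same : M ≈ run ccw (run ccw X q) F'
    same W o = trans (proj₁ (proj₂ (proj₂ joinPQ)) W)
                 (trans (cong (λ m → iter prev m (X W)) (⊔-comm (touches p W) (touches q W)))
                   (sym (proj₁ (proj₂ (proj₂ joinQP)) W)))
    back = reverse-run ccw (run ccw X p) F (proj₁ (proj₂ joinPQ))
    back' = reverse-run ccw (run ccw X q) F' (proj₁ (proj₂ joinQP))

  emptyᶜʷ : ∀ {σ Δ} → ClockwiseEmpty σ Δ → Empty cw σ Δ
  emptyᶜʷ (m₁ , m₂ , m₃) = sidesMatch λ { red → m₁ ; green → m₃ ; blue → m₂ }

  emptyᶜᶜʷ : ∀ {σ Δ} → CounterClockwiseEmpty σ Δ → Empty ccw σ Δ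
  emptyᶜᶜʷ (m₁ , m₂ , m₃) = sidesMatch λ { red → m₁ ; green → m₃ ; blue → m₂ }

  cwMove-result : ∀ {x Δ s'} → CWMove Δ x s' → s' ≈ move cw Δ x
  cwMove-result {x} {Δ} {s'} (_ , after , rest) W o with whichSide-view Δ W
  ... | inj₁ (c , eq) = trans (cong s' (whichSide-just Δ W eq))
                          (trans (proj₂ (side (emptyᶜᶜʷ {s'} {Δ} after) c)) (sym (move-just cw Δ x W eq)))
  ... | inj₂ eq = trans (rest W o (whichSide-nothing Δ W eq)) (sym (move-nothing cw Δ x W eq))

  cwMove : ∀ {x Δ} → Empty cw x Δ → CWMove Δ x (move cw Δ x)
  cwMove {x} {Δ} E =
    (side E red , side E blue , side E green) ,
    (let E' = move-empties-opposite cw x Δ E in side E' red , side E' blue , side E' green) ,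
    λ W o off → move-nothing cw Δ x W (whichSide-none Δ W off)

  reaches-cwMove : ∀ {x Δ y} → CWMove Δ x y → Reaches x y
  reaches-cwMove {x} {Δ} mv = Δ ∷ [] , (emptyᶜʷ (proj₁ mv) , tt) , ≈-sym (cwMove-result mv)

  link-sym : ∀ {x y} → Link x y → Link y x
  link-sym (inj₁ e) = inj₁ (≈-sym e)
  link-sym (inj₂ (inj₁ m)) = inj₂ (inj₂ m)
  link-sym (inj₂ (inj₂ m)) = inj₂ (inj₁ m)

  -- Walking along a path of the state graph from y to x, a state ℓ reaching both a and the current
  -- state is replaced, at each backward move, by a common lower bound.
  component-lower-bound : ∀ {y x} → Star Link y x → ∀ {ℓ a} → Reaches ℓ a → Reaches ℓ y →
                          ∃ λ m → Reaches m a × Reaches m x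
  component-lower-bound ε ra ry = _ , ra , ry
  component-lower-bound (inj₁ e ◅ rest) ra ry = component-lower-bound rest ra (reaches-≈ʳ ry e)
  component-lower-bound (inj₂ (inj₁ (Δ , mv)) ◅ rest) ra ry =
    component-lower-bound rest ra (reaches-trans ry (reaches-cwMove mv))
  component-lower-bound (inj₂ (inj₂ (Δ , mv)) ◅ rest) ra ry with common-lower-bound ry (reaches-cwMove mv)
  ... | m , mℓ , my = component-lower-bound rest (reaches-trans mℓ ra) my

  -- A state without counter-clockwise moves is reached only from itself: the last move of a
  -- nonempty run leaves a counter-clockwise empty triangle.
  last-move-ccw-empty : ∀ x Δ ds → Valid cw x (Δ ∷ ds) → ∃ λ Δ' → Empty ccw (run cw x (Δ ∷ ds)) Δ'
  last-move-ccw-empty x Δ [] (E , tt) = Δ , move-empties-opposite cw x Δ E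
  last-move-ccw-empty x Δ (Δ₂ ∷ ds) (E , v) = last-move-ccw-empty (move cw Δ x) Δ₂ ds v

  reaches-base : ∀ {m a} → NoCCWMove a → Reaches m a → m ≈ a
  reaches-base noCCW ([] , v , r) = r
  reaches-base {m} {a} noCCW (Δ ∷ ds , v , r) with last-move-ccw-empty m Δ ds v
  ... | Δ' , E = ⊥-elim (noCCW Δ' (let E' = empty-≈ ccw Δ' r E in side E' red , side E' blue , side E' green))

  base-unique : ∀ {s t a a'} → Star Link s t → NoCCWMove a → NoCCWMove a' →
                Reaches a s → Reaches a' t → a' ≈ a
  base-unique {a = a} s→t noCCW noCCW' as a't with component-lower-bound s→t {a} {a} ([] , tt , ≈-refl) as
  ... | m , ma , mt with common-lower-bound mt a't
  ...   | m' , m'm , m'a' =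
    ≈-trans (≈-sym (reaches-base noCCW' m'a')) (reaches-base noCCW (reaches-trans m'm ma))

  path-run : ∀ {x y} (p : CWPath x y) → Σ (List (Fin n)) λ ds →
             Valid cw x ds × run cw x ds ≈ y × (∀ Δ → count ds Δ ≡ changes p Δ)
  path-run (done e) = [] , tt , e , λ _ → refl
  path-run {x} (step Δ mv p) with path-run p
  ... | ds , v , r , c =
    Δ ∷ ds , (emptyᶜʷ (proj₁ mv) , valid-≈ cw ds (cwMove-result mv) v) ,
    ≈-trans (run-≈ cw ds (≈-sym (cwMove-result mv))) r , counts
    where
    counts : ∀ Δ' → count (Δ ∷ ds) Δ' ≡ changes (step Δ mv p) Δ'
    counts Δ' with Δ ≟ Δ'
    ... | yes _ = cong suc (c Δ')
    ... | no _ = c Δ'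

  run-path : ∀ x ds → Valid cw x ds → Σ (CWPath x (run cw x ds)) λ p → ∀ Δ → changes p Δ ≡ count ds Δ
  run-path x [] v = done ≈-refl , λ _ → refl
  run-path x (Δ ∷ ds) (E , v) with run-path (move cw Δ x) ds v
  ... | p , c = step Δ (cwMove E) p , counts
    where
    counts : ∀ Δ' → changes (step Δ (cwMove E) p) Δ' ≡ count (Δ ∷ ds) Δ'
    counts Δ' with Δ ≟ Δ'
    ... | yes _ = cong suc (c Δ')
    ... | no _ = c Δ'

  run-links : ∀ x ds → Valid cw x ds → Star Link x (run cw x ds)
  run-links x [] v = ε
  run-links x (Δ ∷ ds) (E , v) = inj₂ (inj₁ (Δ , cwMove E)) ◅ run-links (move cw Δ x) ds v

  -- Clockwise moves preserve states

  rep : Fin n → Color → Fin n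
  rep = cornerRep T

  SV : Color → Fin n → Fin n → Set
  SV = SameVertex T

  SV-trans : ∀ {k X Y Z} → SV k X Y → SV k Y Z → SV k X Z
  SV-trans {k} {X} (m , p) (m' , q) =
    m' + m , trans (iter-+ (rot T k) m' m X) (trans (cong (iter (rot T k) m') p) q)

  rot-injective : ∀ k {X Y} → rot T k X ≡ rot T k Y → X ≡ Y
  rot-injective k {X} {Y} e = trans (sym (unrot X)) (trans (cong (λ z → b (next k) (w (prev k) z)) e) (unrot Y))
    where
    unrot : ∀ X → b (next k) (w (prev k) (rot T k X)) ≡ X
    unrot X = trans (cong (b (next k)) (w-b (prev k) (w (next k) X))) (b-w (next k) X)

  iter-rot-injective : ∀ k m {X Y} → iter (rot T k) m X ≡ iter (rot T k) m Y → X ≡ Y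
  iter-rot-injective k zero e = e
  iter-rot-injective k (suc m) e = iter-rot-injective k m (rot-injective k e)

  -- rotation is a permutation of a finite set, so every black triangle lies on a cycle
  rot-period : ∀ k X → ∃ λ N → iter (rot T k) (suc N) X ≡ X
  rot-period k X with pigeonhole (n<1+n n) (λ (i : Fin (suc n)) → iter (rot T k) (toℕ i) X)
  ... | i , j , i<j , e with m≤n⇒∃[o]m+o≡n i<j
  ...   | o , oe = o , iter-rot-injective k (toℕ i)
           (trans (sym (iter-+ (rot T k) (toℕ i) (suc o) X))
             (trans (cong (λ m → iter (rot T k) m X) (trans (+-suc (toℕ i) o) oe)) (sym e)))

  iter-period : ∀ k P X → iter (rot T k) P X ≡ X → ∀ c → iter (rot T k) (c * P) X ≡ X
  iter-period k P X e zero = refl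
  iter-period k P X e (suc c) =
    trans (iter-+ (rot T k) P (c * P) X) (trans (cong (iter (rot T k) P) (iter-period k P X e c)) e)

  SV-sym : ∀ {k X Y} → SV k X Y → SV k Y X
  SV-sym {k} {X} {Y} (m , p) with rot-period k X
  ... | N , e = m * N , (begin
      iter (rot T k) (m * N) Y                       ≡⟨ cong (iter (rot T k) (m * N)) (sym p) ⟩
      iter (rot T k) (m * N) (iter (rot T k) m X)    ≡⟨ sym (iter-+ (rot T k) (m * N) m X) ⟩
      iter (rot T k) (m * N + m) X                   ≡⟨ cong (λ z → iter (rot T k) z X)
                                                          (trans (+-comm (m * N) m) (sym (*-suc m N))) ⟩
      iter (rot T k) (m * suc N) X                   ≡⟨ iter-period k (suc N) X e m ⟩
      X                                              ∎)
    where open ≡-Reasoning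

  root-transport : ∀ (o : Maybe (Fin n)) k {Y Y'} → SV k Y Y' → isRoot T o k Y → isRoot T o k Y'
  root-transport nothing k sv ()
  root-transport (just O) k sv r = SV-trans r sv

  rep-after : ∀ k Δ → rep (w (next k) Δ) k ≡ Δ
  rep-after k Δ = b-w (next k) Δ

  rep-before : ∀ k Δ → rot T k (rep (w (prev k) Δ) k) ≡ Δ
  rep-before k Δ = trans (cong (b (prev k)) (w-b (next k) (w (prev k) Δ))) (b-w (prev k) Δ)

  Unrooted Injective Surjective : Coloring n → Set
  Unrooted σ = ∀ W k → NotOuter W → σ W ≡ k → ¬ IsRoot k (rep W k)
  Injective σ = ∀ W W' k → NotOuter W → NotOuter W' → σ W ≡ k → σ W' ≡ k →
                SV k (rep W k) (rep W' k) → W ≡ W'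
  Surjective σ = ∀ k Y → ¬ IsRoot k Y → ∃ λ W → NotOuter W × σ W ≡ k × SV k (rep W k) Y

  state-conditions : ∀ σ → IsState σ → Unrooted σ × Injective σ × Surjective σ
  state-conditions σ (c₁ , c₂ , c₃) =
    (λ { W k o refl → c₁ W o }) ,
    (λ { W W' k o o' refl e sv →
           c₂ W W' o o' (sym e) (subst (λ z → SV (σ W) (rep W (σ W)) (rep W' z)) (sym e) sv) }) ,
    c₃

  from-conditions : ∀ σ → Unrooted σ × Injective σ × Surjective σ → IsState σ
  from-conditions σ (p₁ , p₂ , p₃) =
    (λ W o → p₁ W (σ W) o refl) ,
    (λ W W' o o' e sv →
       p₂ W W' (σ W) o o' refl (sym e) (subst (λ z → SV (σ W) (rep W (σ W)) (rep W' z)) (sym e) sv)) ,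
    p₃

  -- A clockwise move at Δ rematches the vertex of colour k from the white triangle oldW k (across
  -- the side opposite prev k) to newW k (across the side opposite next k); both have the same
  -- k-corner as Δ, so the matching stays a bijection avoiding the roots.
  module Preservation {σ Δ} (E : Empty cw σ Δ) (S : IsState σ) where
    t : Coloring n
    t = move cw Δ σ

    unrooted : Unrooted σ
    unrooted = proj₁ (state-conditions σ S)
    injective : Injective σ
    injective = proj₁ (proj₂ (state-conditions σ S))
    surjective : Surjective σ
    surjective = proj₂ (proj₂ (state-conditions σ S))

    oldW newW : Color → Fin n
    oldW k = w (prev k) Δ
    newW k = w (next k) Δ

    σ-old : ∀ k → σ (oldW k) ≡ k
    σ-old k = trans (proj₂ (side E (prev k))) (next-prev k)

    t-new : ∀ k → t (newW k) ≡ k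
    t-new k = trans (move-just cw Δ σ (newW k) (whichSide-empty E (next k))) (prev-next k)

    old-at-Δ : ∀ k → SV k (rep (oldW k) k) Δ
    old-at-Δ k = 1 , rep-before k Δ

    untouched-or-new : ∀ W → (whichSide Δ W ≡ nothing × t W ≡ σ W) ⊎ (∃ λ k → W ≡ newW k × t W ≡ k)
    untouched-or-new W with whichSide-view Δ W
    ... | inj₂ eq = inj₁ (eq , move-nothing cw Δ σ W eq)
    ... | inj₁ (c , eq) = inj₂ (prev c , trans (whichSide-just Δ W eq) (cong (λ z → w z Δ) (sym (next-prev c))) ,
                                 move-just cw Δ σ W eq)

    new-at-Δ : ∀ {W k' k} → W ≡ newW k' → k' ≡ k → rep W k ≡ Δ
    new-at-Δ refl refl = rep-after _ Δ

    t-unrooted : Unrooted t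
    t-unrooted W k o tk with untouched-or-new W
    ... | inj₁ (_ , tσ) = unrooted W k o (trans (sym tσ) tk)
    ... | inj₂ (k' , W≡ , tk') = λ r →
          unrooted (oldW k) k (proj₁ (side E (prev k))) (σ-old k)
            (root-transport out k (SV-sym (old-at-Δ k)) (subst (IsRoot k) (new-at-Δ W≡ (trans (sym tk') tk)) r))

    -- an untouched triangle matched to k does not have the k-corner of Δ as its k-vertex: that
    -- vertex is matched to oldW k, a side of Δ
    untouched-away : ∀ {W k} → whichSide Δ W ≡ nothing → NotOuter W → σ W ≡ k → ¬ SV k (rep W k) Δ
    untouched-away {W} {k} off o σk sv =
      whichSide-nothing Δ W off (prev k)
        (injective W (oldW k) k o (proj₁ (side E (prev k))) σk (σ-old k) (SV-trans sv (SV-sym (old-at-Δ k))))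

    t-injective : Injective t
    t-injective W W' k o o' tk tk' sv with untouched-or-new W | untouched-or-new W'
    ... | inj₁ (_ , tσ) | inj₁ (_ , tσ') = injective W W' k o o' (trans (sym tσ) tk) (trans (sym tσ') tk') sv
    ... | inj₂ (k₁ , W≡ , tk₁) | inj₂ (k₂ , W'≡ , tk₂) =
          trans W≡ (trans (cong newW (trans (trans (sym tk₁) tk) (sym (trans (sym tk₂) tk')))) (sym W'≡))
    ... | inj₂ (k₁ , W≡ , tk₁) | inj₁ (off' , tσ') =
          ⊥-elim (untouched-away off' o' (trans (sym tσ') tk')
            (SV-sym (subst (λ z → SV k z (rep W' k)) (new-at-Δ W≡ (trans (sym tk₁) tk)) sv)))
    ... | inj₁ (off , tσ) | inj₂ (k₂ , W'≡ , tk₂) =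
          ⊥-elim (untouched-away off o (trans (sym tσ) tk)
            (subst (SV k (rep W k)) (new-at-Δ W'≡ (trans (sym tk₂) tk')) sv))

    t-surjective : Surjective t
    t-surjective k Y nr with surjective k Y nr
    ... | W₀ , o₀ , σk , sv with whichSide-view Δ W₀
    ...   | inj₂ eq = W₀ , o₀ , trans (move-nothing cw Δ σ W₀ eq) σk , sv
    ...   | inj₁ (c , eq) = newW k , proj₁ (side E (next k)) , t-new k ,
            subst (λ z → SV k z Y) (sym (rep-after k Δ))
              (SV-trans (SV-sym (old-at-Δ k)) (subst (λ z → SV k (rep z k) Y) W₀-old sv))
      where
      W₀-side : W₀ ≡ w c Δ
      W₀-side = whichSide-just Δ W₀ eq
      c-prev : c ≡ prev k
      c-prev = trans (sym (prev-next c)) (cong prev (trans (sym (proj₂ (side E c))) (trans (cong σ (sym W₀-side)) σk)))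
      W₀-old : W₀ ≡ oldW k
      W₀-old = trans W₀-side (cong (λ z → w z Δ) c-prev)

    t-state : IsState t
    t-state = from-conditions t (t-unrooted , t-injective , t-surjective)

  move-preserves-state : ∀ {σ Δ} → Empty cw σ Δ → IsState σ → IsState (move cw Δ σ)
  move-preserves-state E S = Preservation.t-state E S

  run-preserves-state : ∀ σ ds → IsState σ → Valid cw σ ds → IsState (run cw σ ds)
  run-preserves-state σ [] S v = S
  run-preserves-state σ (Δ ∷ ds) S (E , v) = run-preserves-state (move cw Δ σ) ds (move-preserves-state E S) v

  run-φ : ∀ {s₀ a} → IsState a → NoCCWMove a → Star Link s₀ a → ∀ ds (h : Fin n → ℕ) →
          Valid cw a ds → (∀ Δ → count ds Δ ≡ h Δ) →
          Σ (Coloring n) λ u → InComponent s₀ u × IsPhi u h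
  run-φ {a = a} Sa noCCW s₀→a ds h v counts =
    run cw a ds ,
    (run-preserves-state a ds Sa v , s₀→a ◅◅ run-links a ds v) ,
    (a , Sa , noCCW , proj₁ path , λ Δ → trans (proj₂ path Δ) (counts Δ))
    where
    path = run-path a ds v

  module _ {s₀ a : Coloring n} (Sa : IsState a) (noCCW : NoCCWMove a) (s₀→a : Star Link s₀ a)
           {ds es : List (Fin n)} (vds : Valid cw a ds) (ves : Valid cw a es)
           {f g : Fin n → ℕ} (f≡ : ∀ Δ → count ds Δ ≡ f Δ) (g≡ : ∀ Δ → count es Δ ≡ g Δ) where

    meet-state : Σ (Coloring n) λ u → InComponent s₀ u × IsPhi u (λ Δ → f Δ ⊓ g Δ)
    meet-state with meet-run cw a ds es vds ves
    ... | F , vF , F-counts =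
      run-φ Sa noCCW s₀→a F _ vF (λ Δ → trans (F-counts Δ) (cong₂ _⊓_ (f≡ Δ) (g≡ Δ)))

    join-state : Σ (Coloring n) λ u → InComponent s₀ u × IsPhi u (λ Δ → f Δ ⊔ g Δ)
    join-state with join-run cw a ds es vds ves
    ... | F , vF , _ , F-counts =
      run-φ Sa noCCW s₀→a (ds ++ F) _ (valid-++ cw a ds F vds vF)
        (λ Δ → trans (count-++ ds F Δ) (trans (F-counts Δ) (cong₂ _⊔_ (f≡ Δ) (g≡ Δ))))

  -- The proposition: φ_s and φ_t are realised by runs ds, es from the bases of s and t; the bases
  -- coincide, so meet-state and join-state apply.
  meet-and-join : ∀ (s₀ s t : Coloring n) → InComponent s₀ s → InComponent s₀ t →
    ∀ (f g : Fin n → ℕ) → IsPhi s f → IsPhi t g →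
    (Σ (Coloring n) λ u → InComponent s₀ u × IsPhi u (λ Δ → f Δ ⊓ g Δ))
    × (Σ (Coloring n) λ v → InComponent s₀ v × IsPhi v (λ Δ → f Δ ⊔ g Δ))
  meet-and-join s₀ s t (_ , s₀→s) (_ , s₀→t) f g (a , Sa , noCCW , p , pf) (a' , _ , noCCW' , q , qg)
    with path-run p | path-run q
  ... | ds , vds , ds-end , ds-counts | es , ves , es-end , es-counts =
    meet-state Sa noCCW s₀→a vds ves-from-a f≡ g≡ , join-state Sa noCCW s₀→a vds ves-from-a f≡ g≡
    where
    f≡ : ∀ Δ → count ds Δ ≡ f Δ
    f≡ Δ = trans (ds-counts Δ) (pf Δ)
    g≡ : ∀ Δ → count es Δ ≡ g Δ
    g≡ Δ = trans (es-counts Δ) (qg Δ)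
    s→t : Star Link s t
    s→t = Star.reverse link-sym s₀→s ◅◅ s₀→t
    ves-from-a : Valid cw a es
    ves-from-a = valid-≈ cw es (base-unique s→t noCCW noCCW' (ds , vds , ds-end) (es , ves , es-end)) ves
    s₀→a : Star Link s₀ a
    s₀→a = s₀→s ◅◅ Star.reverse link-sym (run-links a ds vds ◅◅ (inj₁ ds-end ◅ ε))

proposition3p3 : ∀ {n} (T : Trinity n) (out : Maybe (Fin n)) →
    Irreducible T → PlanarOrToric T out →
    let open States T out in
    ∀ (s₀ : Coloring n) → IsState s₀ → Acyclic s₀ →
    ∀ (s t : Coloring n) → InComponent s₀ s → InComponent s₀ t →
    ∀ (f g : Fin n → ℕ) → IsPhi s f → IsPhi t g →
    (Σ (Coloring n) λ u → InComponent s₀ u × IsPhi u (λ Δ → f Δ ⊓ g Δ))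
    × (Σ (Coloring n) λ w → InComponent s₀ w × IsPhi w (λ Δ → f Δ ⊔ g Δ))
proposition3p3 T out _ _ s₀ _ _ = Runs.meet-and-join T out s₀
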